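{- Let $k\ge 3$ and let $G$ be a connected $n$-vertex graph with a $(k,1)$-cover, where $n-k=q(k-1)+r$ with integers $q\ge 0$ and $1\le r\le k-1$, and suppose $G$ has exactly $(q+2)\binom{k}{2}-\binom{k-r}{2}$ edges. Then $G$ has $q+2$ subgraphs $C_0,C_1,\dots,C_{q+1}$, each isomorphic to $K_k$, such that, writing $U_i=V(C_i)$: (1) $E(G)=\bigcup_{i=0}^{q+1}E(C_i)$; (2) for all but at most one $j\in[q+1]$, $|U_j\cap(\bigcup_{i=0}^{j-1}U_i)|=1$; (3) if $j\in[q+1]$ violates (2), then $|U_j\cap(\bigcup_{i=0}^{j-1}U_i)|=k-r$ and there exists $i\in\{0,\dots,j-1\}$ with $|U_i\cap U_j|=k-r$.
   Context: A graph $G$ has a $(k,\ell)$-cover if every edge of $G$ lies in at least $\ell$ copies of $K_k$ (subgraphs isomorphic to the complete graph on $k$ vertices). -}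

module Defs where

open import Data.Nat using (ℕ; zero; suc; _+_; _*_; _∸_; _<_; _≤_)
open import Data.Nat.Combinatorics using (_C_)
open import Data.Bool using (Bool; true; false; if_then_else_)
open import Data.Fin using (Fin; toℕ)
open import Data.Fin.Subset using (Subset; _∈_; ⋃; ∣_∣; _∩_)
open import Data.List using (List; map; filter; allFin)
open import Data.Nat.ListAction using (sum)
open import Data.Product using (Σ; ∃; _×_; _,_)
open import Relation.Nullary using (¬_; does)
open import Relation.Binary.PropositionalEquality using (_≡_; _≢_)
import Data.Nat as ℕ

record Graph (n : ℕ) : Set where
  field
    adj   : Fin n → Fin n → Bool
    sym   : ∀ u v → adj u v ≡ adj v u
    irrefl : ∀ u → adj u u ≡ false

open Graph public

Edge : ∀ {n} → Graph n → Fin n → Fin n → Set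
Edge G u v = adj G u v ≡ true

edgeCount : ∀ {n} → Graph n → ℕ
edgeCount {n} G =
  sum (map (λ u → sum (map (λ v → if does (toℕ u ℕ.<? toℕ v) then (if adj G u v then 1 else 0) else 0)
                           (allFin n)))
           (allFin n))

data Walk {n : ℕ} (G : Graph n) : Fin n → Fin n → Set where
  here : ∀ {u} → Walk G u u
  step : ∀ {u v w} → Edge G u v → Walk G v w → Walk G u w

Connected : ∀ {n} → Graph n → Set
Connected {n} G = ∀ (u v : Fin n) → Walk G u v

-- A vertex set U spans a copy of K_k in G: |U| = k and all distinct
-- vertices of U are adjacent.  (A subgraph isomorphic to K_k is determined
-- by its vertex set, its edges being all pairs in that set.)
IsKkCopy : ∀ {n} → Graph n → ℕ → Subset n → Set
IsKkCopy G k U = ∣ U ∣ ≡ k × (∀ u v → u ∈ U → v ∈ U → u ≢ v → Edge G u v)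

-- (k,ℓ)-cover specialised to ℓ = 1: every edge lies in some copy of K_k.
HasK1Cover : ∀ {n} → Graph n → ℕ → Set
HasK1Cover {n} G k =
  ∀ (u v : Fin n) → Edge G u v → ∃ λ (U : Subset n) → IsKkCopy G k U × u ∈ U × v ∈ U

prefixUnion : ∀ {m n} → (Fin m → Subset n) → Fin m → Subset n
prefixUnion {m} U j = ⋃ (map U (filter (λ i → toℕ i ℕ.<? toℕ j) (allFin m)))

priorMeet : ∀ {m n} → (Fin m → Subset n) → Fin m → ℕ
priorMeet U j = ∣ U j ∩ prefixUnion U j ∣

{-# OPTIONS --safe #-}
module Submission where

-- Grow a chain C₀, C₁, … of copies of K_k greedily: while the union W of the chain misses a vertex,
-- connectivity gives an edge leaving W and the (k,1)-cover a copy of K_k through it, which is appended.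
-- Put K = k − 1 and write |W| = k + aK + ρ with 0 ≤ ρ < K. By induction the chain covers at least
-- (k|W| − k + ρ(K − ρ))/2 pairs, and equality forces every clique to meet its predecessors in a single
-- vertex, except at most one, which meets them in k − ρ vertices lying in one earlier clique.
-- Once W = V(G), the prescribed number of edges equals this bound (with ρ = r, or ρ = 0 when r = K),
-- so equality holds throughout, every edge is covered by the chain, and the chain has q + 2 cliques.

open import Defs hiding (sym)
import Algebra.Properties.CommutativeMonoid.Sum as Summation
open import Data.Bool using (Bool; true; false; _∧_; _∨_; not; if_then_else_)
open import Data.Bool.Properties using (∧-comm; ∧-identityʳ)
open import Data.Fin using (Fin; zero; suc; toℕ; fromℕ<)
import Data.Fin.Properties as Fin
open import Data.Fin.Subset using (Subset; _∈_; _∉_; _⊆_; ∣_∣; _∩_; _∪_; ⊥; ⊤; ⋃)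
open import Data.Fin.Subset.Properties
  using (_∈?_; x∈p∩q⁺; x∈p∩q⁻; x∈p∪q⁺; x∈p∪q⁻; ∉⊥; ∈⊤; ⊆⊤; p∩q⊆p; p∩q⊆q; ∩-comm; ∪-identityˡ; ⊆-antisym;
         ∣p∣≤n; ∣⊤∣≡n; ∣p∣≡n⇒p≡⊤; p⊂q⇒∣p∣<∣q∣; x∈p⇒∣p-x∣<∣p∣; x∈p∧x≢y⇒x∈p-y)
open import Data.List using (List; []; _∷_; map; filter; allFin; tabulate)
import Data.List.Properties as List using (map-tabulate)
open import Data.List.Membership.Propositional using (find; lose)
import Data.List.Membership.Propositional.Properties as ListMem
open import Data.List.Relation.Unary.Any using (Any; here; there)
import Data.List.Relation.Unary.Any.Properties as Any
open import Data.Nat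
  using (ℕ; zero; suc; pred; >-nonZero; _+_; _*_; _∸_; _≤_; _<_; z≤n; s≤s; _≟_; _<?_; _≤?_)
open import Data.Nat.Combinatorics using (_C_; nCk+nC[k+1]≡[n+1]C[k+1]; nC1≡n)
import Data.Nat.ListAction as List using (sum)
open import Data.Nat.Properties
open import Data.Nat.Tactic.RingSolver using (solve-∀)
open import Data.Product using (Σ; ∃; _×_; _,_; proj₁; proj₂)
open import Data.Sum as Sum using (_⊎_; inj₁; inj₂)
open import Data.Vec using ([]; _∷_; lookup)
open import Data.Vec.Properties using (lookup-zipWith; []=⇒lookup; lookup⇒[]=)
open import Function using (_∘_; id; flip)
open import Relation.Binary using (tri<; tri≈; tri>)
open import Relation.Binary.PropositionalEquality
open import Relation.Nullary using (¬_; does; yes; no; contradiction; ¬?; _×-dec_)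

open import Algebra.Properties.CommutativeSemigroup +-commutativeSemigroup using (interchange; x∙yz≈xz∙y)
open Summation +-0-commutativeMonoid using (sum; sum-cong-≗; ∑-distrib-+; sum-replicate-zero)

-- Iverson brackets and sums over pairs

⟦_⟧ : Bool → ℕ
⟦ b ⟧ = if b then 1 else 0

⟦∨⟧+⟦∧⟧ : ∀ a b → ⟦ a ∨ b ⟧ + ⟦ a ∧ b ⟧ ≡ ⟦ a ⟧ + ⟦ b ⟧
⟦∨⟧+⟦∧⟧ true true = refl
⟦∨⟧+⟦∧⟧ true false = refl
⟦∨⟧+⟦∧⟧ false b = +-identityʳ ⟦ b ⟧

⟦∧⟧+⟦not∧⟧ : ∀ a b → ⟦ a ∧ b ⟧ + ⟦ not a ∧ b ⟧ ≡ ⟦ b ⟧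
⟦∧⟧+⟦not∧⟧ true b = +-identityʳ ⟦ b ⟧
⟦∧⟧+⟦not∧⟧ false b = refl

∨≡true⁻ : ∀ {a b} → a ∨ b ≡ true → a ≡ true ⊎ b ≡ true
∨≡true⁻ {true} _ = inj₁ refl
∨≡true⁻ {false} b≡true = inj₂ b≡true

sum≡0⇒≡0 : ∀ {n} (f : Fin n → ℕ) → sum f ≡ 0 → ∀ i → f i ≡ 0
sum≡0⇒≡0 f e zero = m+n≡0⇒m≡0 (f zero) e
sum≡0⇒≡0 f e (suc i) = sum≡0⇒≡0 (λ i → f (suc i)) (m+n≡0⇒n≡0 (f zero) e) i

pairSum : ∀ {n} → (Fin n → Fin n → ℕ) → ℕ
pairSum {zero} f = 0
pairSum {suc n} f = sum (λ v → f zero (suc v)) + pairSum (λ u v → f (suc u) (suc v))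

pairSum-cong : ∀ {n} {f g : Fin n → Fin n → ℕ} → (∀ u v → u ≢ v → f u v ≡ g u v) →
               pairSum f ≡ pairSum g
pairSum-cong {zero} h = refl
pairSum-cong {suc n} h = cong₂ _+_ (sum-cong-≗ (λ v → h zero (suc v) λ ()))
                                   (pairSum-cong (λ u v u≢v → h (suc u) (suc v) (u≢v ∘ Fin.suc-injective)))

pairSum-distrib-+ : ∀ {n} (f g : Fin n → Fin n → ℕ) →
                    pairSum (λ u v → f u v + g u v) ≡ pairSum f + pairSum g
pairSum-distrib-+ {zero} f g = refl
pairSum-distrib-+ {suc n} f g = begin
    sum (λ v → f₀ v + g₀ v) + pairSum (λ u v → f₊ u v + g₊ u v)
  ≡⟨ cong₂ _+_ (∑-distrib-+ f₀ g₀) (pairSum-distrib-+ f₊ g₊) ⟩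
    (sum f₀ + sum g₀) + (pairSum f₊ + pairSum g₊)
  ≡⟨ interchange (sum f₀) (sum g₀) _ _ ⟩
    (sum f₀ + pairSum f₊) + (sum g₀ + pairSum g₊)
  ∎
  where
  open ≡-Reasoning
  f₀ = λ v → f zero (suc v)
  g₀ = λ v → g zero (suc v)
  f₊ = λ u v → f (suc u) (suc v)
  g₊ = λ u v → g (suc u) (suc v)

pairSum≡0⇒≡0 : ∀ {n} (f : Fin n → Fin n → ℕ) → pairSum f ≡ 0 → ∀ u v → toℕ u < toℕ v → f u v ≡ 0
pairSum≡0⇒≡0 f e zero (suc v) _ = sum≡0⇒≡0 (λ v → f zero (suc v)) (m+n≡0⇒m≡0 _ e) v
pairSum≡0⇒≡0 f e (suc u) (suc v) (s≤s u<v) =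
  pairSum≡0⇒≡0 (λ u v → f (suc u) (suc v)) (m+n≡0⇒n≡0 (sum (λ v → f zero (suc v))) e) u v u<v

pairSum≡0⇒≡0-sym : ∀ {n} (f : Fin n → Fin n → ℕ) → (∀ u v → f u v ≡ f v u) →
                   pairSum f ≡ 0 → ∀ u v → u ≢ v → f u v ≡ 0
pairSum≡0⇒≡0-sym f f-sym e u v u≢v with Fin.<-cmp u v
... | tri< u<v _ _ = pairSum≡0⇒≡0 f e u v u<v
... | tri≈ _ u≡v _ = contradiction u≡v u≢v
... | tri> _ _ v<u = trans (f-sym u v) (pairSum≡0⇒≡0 f e v u v<u)

sum-allFin : ∀ {n} (f : Fin n → ℕ) → List.sum (map f (allFin n)) ≡ sum f
sum-allFin {n} f = trans (cong List.sum (List.map-tabulate {n = n} (λ i → i) f)) (sum-tabulate f)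
  where
  sum-tabulate : ∀ {n} (f : Fin n → ℕ) → List.sum (tabulate f) ≡ sum f
  sum-tabulate {zero} f = refl
  sum-tabulate {suc n} f = cong (f zero +_) (sum-tabulate (f ∘ suc))

edgeCount≡pairSum : ∀ {n} (G : Graph n) → edgeCount G ≡ pairSum (λ u v → ⟦ adj G u v ⟧)
edgeCount≡pairSum {n} G = begin
  edgeCount G                                    ≡⟨ sum-allFin (λ u → List.sum (map (row u) (allFin n))) ⟩
  sum (λ u → List.sum (map (row u) (allFin n)))  ≡⟨ sum-cong-≗ (λ u → sum-allFin (row u)) ⟩
  sum (λ u → sum (row u))                        ≡⟨ sum<≡pairSum e ⟩
  pairSum e                                      ∎
  where
  open ≡-Reasoning
  e = λ u v → ⟦ adj G u v ⟧
  row = λ u v → if does (toℕ u <? toℕ v) then e u v else 0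
  sum<≡pairSum : ∀ {n} (f : Fin n → Fin n → ℕ) →
    sum (λ u → sum (λ v → if does (toℕ u <? toℕ v) then f u v else 0)) ≡ pairSum f
  sum<≡pairSum {zero} f = refl
  sum<≡pairSum {suc n} f =
    cong (sum (λ v → f zero (suc v)) +_) (sum<≡pairSum (λ u v → f (suc u) (suc v)))

-- Cardinalities of subsets

lookup-∩ : ∀ {n} (p q : Subset n) x → lookup (p ∩ q) x ≡ lookup p x ∧ lookup q x
lookup-∩ p q x = lookup-zipWith _∧_ x p q

lookup-∪ : ∀ {n} (p q : Subset n) x → lookup (p ∪ q) x ≡ lookup p x ∨ lookup q x
lookup-∪ p q x = lookup-zipWith _∨_ x p q

∈⇒lookup : ∀ {n} {p : Subset n} {x} → x ∈ p → lookup p x ≡ true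
∈⇒lookup = []=⇒lookup

lookup⇒∈ : ∀ {n} {p : Subset n} {x} → lookup p x ≡ true → x ∈ p
lookup⇒∈ {p = p} {x} = lookup⇒[]= x p

∣p∣≡sum : ∀ {n} (p : Subset n) → ∣ p ∣ ≡ sum (λ x → ⟦ lookup p x ⟧)
∣p∣≡sum [] = refl
∣p∣≡sum (true ∷ p) = cong suc (∣p∣≡sum p)
∣p∣≡sum (false ∷ p) = ∣p∣≡sum p

∣p∪q∣+∣p∩q∣≡∣p∣+∣q∣ : ∀ {n} (p q : Subset n) → ∣ p ∪ q ∣ + ∣ p ∩ q ∣ ≡ ∣ p ∣ + ∣ q ∣
∣p∪q∣+∣p∩q∣≡∣p∣+∣q∣ p q = begin
    ∣ p ∪ q ∣ + ∣ p ∩ q ∣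
  ≡⟨ cong₂ _+_ (∣p∣≡sum (p ∪ q)) (∣p∣≡sum (p ∩ q)) ⟩
    sum (λ x → ⟦ lookup (p ∪ q) x ⟧) + sum (λ x → ⟦ lookup (p ∩ q) x ⟧)
  ≡⟨ ∑-distrib-+ (λ x → ⟦ lookup (p ∪ q) x ⟧) (λ x → ⟦ lookup (p ∩ q) x ⟧) ⟨
    sum (λ x → ⟦ lookup (p ∪ q) x ⟧ + ⟦ lookup (p ∩ q) x ⟧)
  ≡⟨ sum-cong-≗ pointwise ⟩
    sum (λ x → ⟦ lookup p x ⟧ + ⟦ lookup q x ⟧)
  ≡⟨ ∑-distrib-+ (λ x → ⟦ lookup p x ⟧) (λ x → ⟦ lookup q x ⟧) ⟩
    sum (λ x → ⟦ lookup p x ⟧) + sum (λ x → ⟦ lookup q x ⟧)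
  ≡⟨ cong₂ _+_ (∣p∣≡sum p) (∣p∣≡sum q) ⟨
    ∣ p ∣ + ∣ q ∣
  ∎
  where
  open ≡-Reasoning
  pointwise : ∀ x → ⟦ lookup (p ∪ q) x ⟧ + ⟦ lookup (p ∩ q) x ⟧ ≡ ⟦ lookup p x ⟧ + ⟦ lookup q x ⟧
  pointwise x rewrite lookup-∪ p q x | lookup-∩ p q x = ⟦∨⟧+⟦∧⟧ (lookup p x) (lookup q x)

x∈p⇒1≤∣p∣ : ∀ {n} {p : Subset n} {x} → x ∈ p → 1 ≤ ∣ p ∣
x∈p⇒1≤∣p∣ x∈p = ≤-trans (s≤s z≤n) (x∈p⇒∣p-x∣<∣p∣ x∈p)

x,y∈p⇒2≤∣p∣ : ∀ {n} {p : Subset n} {x y} → x ∈ p → y ∈ p → x ≢ y → 2 ≤ ∣ p ∣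
x,y∈p⇒2≤∣p∣ x∈p y∈p x≢y = ≤-trans (s≤s (x∈p⇒1≤∣p∣ (x∈p∧x≢y⇒x∈p-y y∈p (x≢y ∘ sym)))) (x∈p⇒∣p-x∣<∣p∣ x∈p)

2*[1+n]C2≡[1+n]*n : ∀ n → 2 * (suc n C 2) ≡ suc n * n
2*[1+n]C2≡[1+n]*n zero = refl
2*[1+n]C2≡[1+n]*n (suc n) = begin
    2 * (suc (suc n) C 2)
  ≡⟨ cong (2 *_) (nCk+nC[k+1]≡[n+1]C[k+1] (suc n) 1) ⟨
    2 * (suc n C 1 + suc n C 2)
  ≡⟨ *-distribˡ-+ 2 (suc n C 1) (suc n C 2) ⟩
    2 * (suc n C 1) + 2 * (suc n C 2)
  ≡⟨ cong₂ _+_ (cong (2 *_) (nC1≡n (suc n))) (2*[1+n]C2≡[1+n]*n n) ⟩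
    2 * suc n + suc n * n
  ≡⟨ arith n ⟩
    suc (suc n) * suc n
  ∎
  where
  open ≡-Reasoning
  arith : ∀ n → 2 * suc n + suc n * n ≡ suc (suc n) * suc n
  arith = solve-∀

pairSum-inside : ∀ {n} (p : Subset n) → pairSum (λ u v → ⟦ lookup p u ∧ lookup p v ⟧) ≡ ∣ p ∣ C 2
pairSum-inside [] = refl
pairSum-inside (true ∷ p) = begin
    sum (λ v → ⟦ lookup p v ⟧) + pairSum (λ u v → ⟦ lookup p u ∧ lookup p v ⟧)
  ≡⟨ cong₂ _+_ (sym (∣p∣≡sum p)) (pairSum-inside p) ⟩
    ∣ p ∣ + ∣ p ∣ C 2
  ≡⟨ cong (_+ ∣ p ∣ C 2) (nC1≡n ∣ p ∣) ⟨
    ∣ p ∣ C 1 + ∣ p ∣ C 2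
  ≡⟨ nCk+nC[k+1]≡[n+1]C[k+1] ∣ p ∣ 1 ⟩
    suc ∣ p ∣ C 2
  ∎
  where open ≡-Reasoning
pairSum-inside {suc n} (false ∷ p) = cong₂ _+_ (sum-replicate-zero n) (pairSum-inside p)

-- Arithmetic of the potential

2*[m*n]≡0⇒ : ∀ m n → 2 * (m * n) ≡ 0 → m ≡ 0 ⊎ n ≡ 0
2*[m*n]≡0⇒ m n e = m*n≡0⇒m≡0∨n≡0 m (m+n≡0⇒m≡0 (m * n) e)

-- Appending a clique with t' + 1 old and s new vertices turns the defect term ρ ρ' of the potential
-- into ρ ρ' + s t'; this is the defect ρ₁ ρ₁' of the new remainder ρ₁ ≡ ρ + s (mod K) plus an excess.
record RemainderStep (K s t' ρ ρ' : ℕ) : Set where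
  field
    ρ₁ ρ₁' excess : ℕ
    ρ₁+ρ₁'≡K : ρ₁ + ρ₁' ≡ K
    1≤ρ₁' : 1 ≤ ρ₁'
    defect : ρ * ρ' + s * t' ≡ ρ₁ * ρ₁' + excess
    carry : (ρ + s ≡ ρ₁ × excess ≡ 2 * (ρ * s)) ⊎ (ρ + s ≡ K + ρ₁ × excess ≡ 2 * (t' * ρ'))

no-wrap : ∀ ρ s e {t'} → s + t' ≡ ρ + (suc s + e) →
          RemainderStep (ρ + (suc s + e)) s t' ρ (suc s + e)
no-wrap ρ s e {t'} s+t'≡K = subst (λ t' → RemainderStep _ s t' ρ _) (sym t'≡ρ+1+e) (record
  { ρ₁ = ρ + s ; ρ₁' = suc e ; excess = 2 * (ρ * s)
  ; ρ₁+ρ₁'≡K = shuffle′ ρ s e ; 1≤ρ₁' = s≤s z≤n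
  ; defect = identity ρ s e ; carry = inj₁ (refl , refl) })
  where
  shuffle : ∀ ρ s e → ρ + (suc s + e) ≡ s + (ρ + suc e)
  shuffle = solve-∀
  shuffle′ : ∀ ρ s e → ρ + s + suc e ≡ ρ + (suc s + e)
  shuffle′ = solve-∀
  identity : ∀ ρ s e → ρ * (suc s + e) + s * (ρ + suc e) ≡ (ρ + s) * suc e + 2 * (ρ * s)
  identity = solve-∀
  t'≡ρ+1+e : t' ≡ ρ + suc e
  t'≡ρ+1+e = +-cancelˡ-≡ s t' (ρ + suc e) (trans s+t'≡K (shuffle ρ s e))

wrap : ∀ ρ ρ' e {t'} → 1 ≤ ρ' → (ρ' + e) + t' ≡ ρ + ρ' →
       RemainderStep (ρ + ρ') (ρ' + e) t' ρ ρ'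
wrap ρ ρ' e {t'} 1≤ρ' s+t'≡K = subst (λ ρ → RemainderStep (ρ + ρ') (ρ' + e) t' ρ ρ') (sym ρ≡e+t') (record
  { ρ₁ = e ; ρ₁' = t' + ρ' ; excess = 2 * (t' * ρ')
  ; ρ₁+ρ₁'≡K = sym (+-assoc e t' ρ') ; 1≤ρ₁' = ≤-trans 1≤ρ' (m≤n+m ρ' t')
  ; defect = identity e t' ρ' ; carry = inj₂ (shuffle e t' ρ' , refl) })
  where
  shuffle : ∀ e t' ρ' → (e + t') + (ρ' + e) ≡ ((e + t') + ρ') + e
  shuffle = solve-∀
  identity : ∀ e t' ρ' → (e + t') * ρ' + (ρ' + e) * t' ≡ e * (t' + ρ') + 2 * (t' * ρ')
  identity = solve-∀
  ρ≡e+t' : ρ ≡ e + t'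
  ρ≡e+t' = +-cancelˡ-≡ ρ' ρ (e + t') (trans (+-comm ρ' ρ) (trans (sym s+t'≡K) (+-assoc ρ' e t')))

remainder-step : ∀ {K s t' ρ ρ'} → s + t' ≡ K → ρ + ρ' ≡ K → 1 ≤ ρ' → RemainderStep K s t' ρ ρ'
remainder-step {s = s} {ρ = ρ} {ρ'} s+t'≡K refl 1≤ρ' with s <? ρ'
... | yes s<ρ' with m≤n⇒∃[o]m+o≡n s<ρ'
...   | e , refl = no-wrap ρ s e s+t'≡K
remainder-step {s = s} {ρ = ρ} {ρ'} s+t'≡K refl 1≤ρ' | no s≮ρ' with m≤n⇒∃[o]m+o≡n (≮⇒≥ s≮ρ')
...   | e , refl = wrap ρ ρ' e 1≤ρ' s+t'≡K

potential-step : ∀ {K s t' w P P′ ν δ σ R R₁ E} → s + t' ≡ K → let k = suc K in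
  P′ + ν ≡ P + k C 2 → ν + δ ≡ suc t' C 2 →
  2 * P + k ≡ k * w + R + σ → R + s * t' ≡ R₁ + E →
  2 * P′ + k ≡ k * (w + s) + R₁ + (σ + 2 * δ + E)
potential-step {s = s} {t'} {w} {P} {P′} {ν} {δ} {σ} {R} {R₁} {E}
               refl new-pairs shared-pairs potential defect =
  +-cancelʳ-≡ (2 * (suc t' C 2)) _ _ (begin
    (2 * P′ + k) + 2 * (suc t' C 2)      ≡⟨ cong (λ x → (2 * P′ + k) + 2 * x) shared-pairs ⟨
    (2 * P′ + k) + 2 * (ν + δ)           ≡⟨ regroup₁ P′ k ν δ ⟩
    2 * (P′ + ν) + k + 2 * δ             ≡⟨ cong (λ x → 2 * x + k + 2 * δ) new-pairs ⟩
    2 * (P + k C 2) + k + 2 * δ          ≡⟨ regroup₂ P (k C 2) k δ ⟩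
    (2 * P + k) + 2 * (k C 2) + 2 * δ
      ≡⟨ cong₂ (λ x y → x + y + 2 * δ) potential (2*[1+n]C2≡[1+n]*n (s + t')) ⟩
    (k * w + R + σ) + k * (s + t') + 2 * δ
      ≡⟨ regroup₃ s t' w R σ δ ⟩
    k * (w + s) + (R + s * t') + σ + 2 * δ + suc t' * t'
      ≡⟨ cong₂ (λ x y → k * (w + s) + x + σ + 2 * δ + y) defect (sym (2*[1+n]C2≡[1+n]*n t')) ⟩
    k * (w + s) + (R₁ + E) + σ + 2 * δ + 2 * (suc t' C 2)
      ≡⟨ regroup₄ (k * (w + s)) R₁ E σ δ (2 * (suc t' C 2)) ⟩
    (k * (w + s) + R₁ + (σ + 2 * δ + E)) + 2 * (suc t' C 2) ∎)
  where
  open ≡-Reasoning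
  k = suc (s + t')
  regroup₁ : ∀ P′ k ν δ → (2 * P′ + k) + 2 * (ν + δ) ≡ 2 * (P′ + ν) + k + 2 * δ
  regroup₁ = solve-∀
  regroup₂ : ∀ P c k δ → 2 * (P + c) + k + 2 * δ ≡ (2 * P + k) + 2 * c + 2 * δ
  regroup₂ = solve-∀
  regroup₃ : ∀ s t' w R σ δ → let k = suc (s + t') in
    (k * w + R + σ) + k * (s + t') + 2 * δ ≡ k * (w + s) + (R + s * t') + σ + 2 * δ + suc t' * t'
  regroup₃ = solve-∀
  regroup₄ : ∀ X R₁ E σ δ T → X + (R₁ + E) + σ + 2 * δ + T ≡ (X + R₁ + (σ + 2 * δ + E)) + T
  regroup₄ = solve-∀

quotient-remainder-unique : ∀ K a b x y → x < K → y < K → a * K + x ≡ b * K + y → a ≡ b × x ≡ y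
quotient-remainder-unique K zero zero x y _ _ e = refl , e
quotient-remainder-unique K (suc a) zero x y _ y<K e =
  contradiction (subst (K ≤_) e (≤-trans (m≤m+n K (a * K)) (m≤m+n (K + a * K) x))) (<⇒≱ y<K)
quotient-remainder-unique K zero (suc b) x y x<K _ e =
  contradiction (subst (K ≤_) (sym e) (≤-trans (m≤m+n K (b * K)) (m≤m+n (K + b * K) y))) (<⇒≱ x<K)
quotient-remainder-unique K (suc a) (suc b) x y x<K y<K e
  with quotient-remainder-unique K a b x y x<K y<K
         (+-cancelˡ-≡ K _ _ (trans (sym (+-assoc K (a * K) x)) (trans e (+-assoc K (b * K) y))))
... | refl , refl = refl , refl

record Extremal (q r a ρ σ missing : ℕ) : Set where
  field
    σ≡0 : σ ≡ 0
    missing≡0 : missing ≡ 0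
    position : (ρ ≡ 0 × a ≡ suc q) ⊎ (ρ ≡ r × a ≡ q)

extremal-position : ∀ q r r' a ρ ρ' σ missing → 1 ≤ r → ρ + ρ' ≡ r + r' → 1 ≤ ρ' →
  ρ * ρ' + (σ + 2 * missing) ≡ r * r' → a * (r + r') + ρ ≡ q * (r + r') + r →
  Extremal q r a ρ σ missing
extremal-position q r zero a ρ ρ' σ missing 1≤r ρ+ρ'≡K 1≤ρ' defect position
  with quotient-remainder-unique (r + 0) a (suc q) ρ 0
         (subst (ρ <_) ρ+ρ'≡K (m<m+n ρ 1≤ρ')) (≤-trans 1≤r (m≤m+n r 0))
         (trans position (trans (cong (q * (r + 0) +_) (sym (+-identityʳ r)))
                                (trans (+-comm (q * (r + 0)) (r + 0)) (sym (+-identityʳ _)))))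
... | refl , refl = record { σ≡0 = σ≡0 ; missing≡0 = missing≡0 ; position = inj₁ (refl , refl) }
  where
  σ+2m≡0 = trans defect (*-zeroʳ r)
  σ≡0 = m+n≡0⇒m≡0 σ σ+2m≡0
  missing≡0 = m+n≡0⇒m≡0 missing (m+n≡0⇒n≡0 σ σ+2m≡0)
extremal-position q r (suc r'') a ρ ρ' σ missing 1≤r ρ+ρ'≡K 1≤ρ' defect position
  with quotient-remainder-unique (r + suc r'') a q ρ r
         (subst (ρ <_) ρ+ρ'≡K (m<m+n ρ 1≤ρ')) (m<m+n r (s≤s z≤n)) position
... | refl , refl with +-cancelˡ-≡ r ρ' (suc r'') ρ+ρ'≡K
...   | refl = record { σ≡0 = σ≡0 ; missing≡0 = missing≡0 ; position = inj₂ (refl , refl) }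
  where
  σ+2m≡0 = +-cancelˡ-≡ (r * suc r'') _ 0 (trans defect (sym (+-identityʳ _)))
  σ≡0 = m+n≡0⇒m≡0 σ σ+2m≡0
  missing≡0 = m+n≡0⇒m≡0 missing (m+n≡0⇒n≡0 σ σ+2m≡0)

extremal : ∀ {K q r w P missing a ρ ρ' σ} → 1 ≤ r → r ≤ K → w ≡ suc K + q * K + r →
  P + missing ≡ (q + 2) * (suc K C 2) ∸ ((suc K ∸ r) C 2) →
  2 * P + suc K ≡ suc K * w + ρ * ρ' + σ → w ≡ suc K + a * K + ρ → ρ + ρ' ≡ K → 1 ≤ ρ' →
  Extremal q r a ρ σ missing
extremal {q = q} {r} {w} {P} {missing} {a} {ρ} {ρ'} {σ} 1≤r r≤K w≡ edges potential w≡′ ρ+ρ'≡K 1≤ρ'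
  with m≤n⇒∃[o]m+o≡n r≤K
... | r' , refl = extremal-position q r r' a ρ ρ' σ missing 1≤r ρ+ρ'≡K 1≤ρ' defect position
  where
  open ≡-Reasoning
  K = r + r'
  k = suc K
  c = (k ∸ r) C 2
  2c≡ : 2 * c ≡ suc r' * r'
  2c≡ = trans (cong (λ x → 2 * (x C 2)) (trans (cong (_∸ r) (sym (+-suc r r'))) (m+n∸m≡n r (suc r'))))
              (2*[1+n]C2≡[1+n]*n r')
  c≤ : c ≤ (q + 2) * (k C 2)
  c≤ = ≤-trans (*-cancelˡ-≤ 2 (subst₂ _≤_ (sym 2c≡) (sym (2*[1+n]C2≡[1+n]*n K))
                                      (*-mono-≤ (s≤s (m≤n+m r' r)) (m≤n+m r' r))))
               (subst (λ x → k C 2 ≤ x * (k C 2)) (+-comm 2 q) (m≤m+n (k C 2) _))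
  2E+k : 2 * (P + missing) + k ≡ k * w + r * r'
  2E+k = +-cancelʳ-≡ (2 * c) _ _ (begin
    2 * (P + missing) + k + 2 * c          ≡⟨ regroup (P + missing) c k ⟩
    2 * (P + missing + c) + k              ≡⟨ cong (λ x → 2 * (x + c) + k) edges ⟩
    2 * ((q + 2) * (k C 2) ∸ c + c) + k    ≡⟨ cong (λ x → 2 * x + k) (m∸n+n≡m c≤) ⟩
    2 * ((q + 2) * (k C 2)) + k            ≡⟨ cong (_+ k) (swap q (k C 2)) ⟩
    (q + 2) * (2 * (k C 2)) + k            ≡⟨ cong (λ x → (q + 2) * x + k) (2*[1+n]C2≡[1+n]*n K) ⟩
    (q + 2) * (k * K) + k                  ≡⟨ count q r r' ⟩
    k * (k + q * K + r) + r * r' + suc r' * r' ≡⟨ cong₂ (λ x y → k * x + r * r' + y) (sym w≡) (sym 2c≡) ⟩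
    k * w + r * r' + 2 * c                 ∎)
    where
    regroup : ∀ E c k → 2 * E + k + 2 * c ≡ 2 * (E + c) + k
    regroup = solve-∀
    swap : ∀ q c → 2 * ((q + 2) * c) ≡ (q + 2) * (2 * c)
    swap = solve-∀
    count : ∀ q r r' → let K = r + r' in let k = suc K in
            (q + 2) * (k * K) + k ≡ k * (k + q * K + r) + r * r' + suc r' * r'
    count = solve-∀
  defect : ρ * ρ' + (σ + 2 * missing) ≡ r * r'
  defect = +-cancelˡ-≡ (k * w) _ _ (begin
    k * w + (ρ * ρ' + (σ + 2 * missing)) ≡⟨ regroup (k * w) (ρ * ρ') σ missing ⟩
    k * w + ρ * ρ' + σ + 2 * missing     ≡⟨ cong (_+ 2 * missing) potential ⟨
    2 * P + k + 2 * missing              ≡⟨ regroup′ P missing k ⟩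
    2 * (P + missing) + k                ≡⟨ 2E+k ⟩
    k * w + r * r'                       ∎)
    where
    regroup : ∀ X R σ m → X + (R + (σ + 2 * m)) ≡ X + R + σ + 2 * m
    regroup = solve-∀
    regroup′ : ∀ P m k → 2 * P + k + 2 * m ≡ 2 * (P + m) + k
    regroup′ = solve-∀
  position : a * K + ρ ≡ q * K + r
  position = +-cancelˡ-≡ k _ _
    (trans (sym (+-assoc k (a * K) ρ)) (trans (sym w≡′) (trans w≡ (+-assoc k (q * K) r))))

-- Chains of vertex sets

module _ {n : ℕ} where

  prefix : (ℕ → Subset n) → ℕ → Subset n
  prefix Cs zero = ⊥
  prefix Cs (suc j) = prefix Cs j ∪ Cs j

  ∈-prefix⁻ : ∀ {Cs j x} → x ∈ prefix Cs j → ∃ λ i → i < j × x ∈ Cs i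
  ∈-prefix⁻ {j = zero} x∈⊥ = contradiction x∈⊥ ∉⊥
  ∈-prefix⁻ {Cs} {suc j} x∈ with x∈p∪q⁻ (prefix Cs j) (Cs j) x∈
  ... | inj₁ x∈pre = let i , i<j , x∈Cᵢ = ∈-prefix⁻ x∈pre in i , m<n⇒m<1+n i<j , x∈Cᵢ
  ... | inj₂ x∈Cⱼ = j , ≤-refl , x∈Cⱼ

  ∈-prefix⁺ : ∀ {Cs i j x} → i < j → x ∈ Cs i → x ∈ prefix Cs j
  ∈-prefix⁺ {j = suc j} (s≤s i≤j) x∈Cᵢ with m≤n⇒m<n∨m≡n i≤j
  ... | inj₁ i<j = x∈p∪q⁺ (inj₁ (∈-prefix⁺ i<j x∈Cᵢ))
  ... | inj₂ refl = x∈p∪q⁺ (inj₂ x∈Cᵢ)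

  inBoth : Subset n → Fin n → Fin n → Bool
  inBoth p u v = lookup p u ∧ lookup p v

  inBoth⁻ : ∀ {p u v} → inBoth p u v ≡ true → u ∈ p × v ∈ p
  inBoth⁻ {p} {u} {v} e with lookup p u in eu | lookup p v in ev
  ... | true | true = lookup⇒∈ eu , lookup⇒∈ ev

  inBoth⁺ : ∀ {p u v} → u ∈ p → v ∈ p → inBoth p u v ≡ true
  inBoth⁺ u∈p v∈p rewrite ∈⇒lookup u∈p | ∈⇒lookup v∈p = refl

  covered : (ℕ → Subset n) → ℕ → Fin n → Fin n → Bool
  covered Cs zero u v = inBoth (Cs 0) u v
  covered Cs (suc m) u v = covered Cs m u v ∨ inBoth (Cs (suc m)) u v

  covered⁻ : ∀ {Cs} m {u v} → covered Cs m u v ≡ true → ∃ λ i → i ≤ m × u ∈ Cs i × v ∈ Cs i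
  covered⁻ zero e = 0 , z≤n , inBoth⁻ e
  covered⁻ {Cs} (suc m) {u} {v} e with covered Cs m u v in eq
  ... | true = let i , i≤m , both = covered⁻ m eq in i , m≤n⇒m≤1+n i≤m , both
  ... | false = suc m , ≤-refl , inBoth⁻ e

  covered⇒∈prefix : ∀ {Cs} m {u v} → covered Cs m u v ≡ true →
                    u ∈ prefix Cs (suc m) × v ∈ prefix Cs (suc m)
  covered⇒∈prefix m e =
    let i , i≤m , u∈ , v∈ = covered⁻ m e in ∈-prefix⁺ (s≤s i≤m) u∈ , ∈-prefix⁺ (s≤s i≤m) v∈

  covered-sym : ∀ Cs m u v → covered Cs m u v ≡ covered Cs m v u
  covered-sym Cs zero u v = ∧-comm (lookup (Cs 0) u) _
  covered-sym Cs (suc m) u v = cong₂ _∨_ (covered-sym Cs m u v) (∧-comm (lookup (Cs (suc m)) u) _)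

  attachment : (ℕ → Subset n) → ℕ → ℕ
  attachment Cs j = ∣ Cs j ∩ prefix Cs j ∣

  extend : (ℕ → Subset n) → ℕ → Subset n → ℕ → Subset n
  extend Cs m D i with i ≤? m
  ... | yes _ = Cs i
  ... | no _ = D

  extend-old : ∀ Cs m D {i} → i ≤ m → extend Cs m D i ≡ Cs i
  extend-old Cs m D {i} i≤m with i ≤? m
  ... | yes _ = refl
  ... | no i≰m = contradiction i≤m i≰m

  extend-new : ∀ Cs m D → extend Cs m D (suc m) ≡ D
  extend-new Cs m D with suc m ≤? m
  ... | yes 1+m≤m = contradiction 1+m≤m (n≮n m)
  ... | no _ = refl

  prefix-extend : ∀ Cs m D {j} → j ≤ suc m → prefix (extend Cs m D) j ≡ prefix Cs j
  prefix-extend Cs m D {zero} _ = refl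
  prefix-extend Cs m D {suc j} (s≤s j≤m) =
    cong₂ _∪_ (prefix-extend Cs m D (m≤n⇒m≤1+n j≤m)) (extend-old Cs m D j≤m)

  covered-extend : ∀ Cs m D {j} → j ≤ m → ∀ u v → covered (extend Cs m D) j u v ≡ covered Cs j u v
  covered-extend Cs m D {zero} _ u v = cong (λ p → inBoth p u v) (extend-old Cs m D z≤n)
  covered-extend Cs m D {suc j} 1+j≤m u v =
    cong₂ _∨_ (covered-extend Cs m D (<⇒≤ 1+j≤m) u v) (cong (λ p → inBoth p u v) (extend-old Cs m D 1+j≤m))

  attachment-extend : ∀ Cs m D {j} → j ≤ m → attachment (extend Cs m D) j ≡ attachment Cs j
  attachment-extend Cs m D j≤m =
    cong₂ (λ p q → ∣ p ∩ q ∣) (extend-old Cs m D j≤m) (prefix-extend Cs m D (m≤n⇒m≤1+n j≤m))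

∈-⋃⁻ : ∀ {n} (L : List (Subset n)) {x} → x ∈ ⋃ L → Any (x ∈_) L
∈-⋃⁻ [] x∈⊥ = contradiction x∈⊥ ∉⊥
∈-⋃⁻ (S ∷ L) x∈ = Sum.[ here , there ∘ ∈-⋃⁻ L ]′ (x∈p∪q⁻ S (⋃ L) x∈)

∈-⋃⁺ : ∀ {n} {L : List (Subset n)} {x} → Any (x ∈_) L → x ∈ ⋃ L
∈-⋃⁺ (here x∈S) = x∈p∪q⁺ (inj₁ x∈S)
∈-⋃⁺ (there x∈⋃L) = x∈p∪q⁺ (inj₂ (∈-⋃⁺ x∈⋃L))

∈-prefixUnion⁻ : ∀ {m n} (U : Fin m → Subset n) j {x} → x ∈ prefixUnion U j →
                 ∃ λ i → toℕ i < toℕ j × x ∈ U i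
∈-prefixUnion⁻ {m} U j x∈ =
  let i , i∈ , x∈Uᵢ = find (Any.map⁻ (∈-⋃⁻ (map U (filter (λ i → toℕ i <? toℕ j) (allFin m))) x∈))
  in i , proj₂ (ListMem.∈-filter⁻ (λ i → toℕ i <? toℕ j) {xs = allFin m} i∈) , x∈Uᵢ

∈-prefixUnion⁺ : ∀ {m n} (U : Fin m → Subset n) {i j x} → toℕ i < toℕ j → x ∈ U i → x ∈ prefixUnion U j
∈-prefixUnion⁺ {m} U {i} {j} i<j x∈Uᵢ =
  ∈-⋃⁺ (Any.map⁺ (lose (ListMem.∈-filter⁺ (λ i → toℕ i <? toℕ j) (ListMem.∈-allFin i) i<j) x∈Uᵢ))

crossing-edge : ∀ {n} {G : Graph n} (W : Subset n) {a b} → Walk G a b → a ∈ W → b ∉ W →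
                ∃ λ x → ∃ λ y → Edge G x y × x ∈ W × y ∉ W
crossing-edge W here a∈W a∉W = contradiction a∈W a∉W
crossing-edge W (step {v = v} e walk) a∈W b∉W with v ∈? W
... | yes v∈W = crossing-edge W walk v∈W b∉W
... | no v∉W = _ , v , e , a∈W , v∉W

first-edge : ∀ {n} {G : Graph n} {a b} → Walk G a b → a ≢ b → ∃ λ v → Edge G a v
first-edge here a≢a = contradiction refl a≢a
first-edge (step e _) _ = _ , e

-- The greedy clique chain

module Greedy {n : ℕ} (G : Graph n) (K : ℕ) where

  k : ℕ
  k = suc K

  coveredPairs : (ℕ → Subset n) → ℕ → ℕ
  coveredPairs Cs m = pairSum (λ u v → ⟦ covered Cs m u v ⟧)

  -- Holds while all attachments are single vertices; it locates the earlier clique that contains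
  -- the one large attachment.
  InOneBlock : ℕ → (ℕ → Subset n) → Set
  InOneBlock m Cs = ∀ T → T ⊆ prefix Cs (suc m) →
    (∀ {x y} → x ∈ T → y ∈ T → x ≢ y → covered Cs m x y ≡ true) →
    ∃ λ i → i ≤ m × T ⊆ Cs i

  -- The two extremal configurations of conclusions (2) and (3).
  data Shape (m : ℕ) (Cs : ℕ → Subset n) (a ρ : ℕ) : Set where
    tree : ρ ≡ 0 → m ≡ a → (∀ j → 1 ≤ j → j ≤ m → attachment Cs j ≡ 1) → InOneBlock m Cs →
           Shape m Cs a ρ
    one-overlap : 1 ≤ ρ → m ≡ suc a → (j₀ : ℕ) → 1 ≤ j₀ → j₀ ≤ m → attachment Cs j₀ + ρ ≡ k →
                  (∀ j → 1 ≤ j → j ≤ m → j ≢ j₀ → attachment Cs j ≡ 1) →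
                  (i : ℕ) → i < j₀ → ∣ Cs i ∩ Cs j₀ ∣ ≡ attachment Cs j₀ → Shape m Cs a ρ

  record CliqueChain : Set where
    field
      m : ℕ
      Cs : ℕ → Subset n
      clique : ∀ i → i ≤ m → IsKkCopy G k (Cs i)
      root : Fin n
      root∈Cs₀ : root ∈ Cs 0
      a ρ ρ' σ : ℕ
      ρ+ρ'≡K : ρ + ρ' ≡ K
      1≤ρ' : 1 ≤ ρ'
      size : ∣ prefix Cs (suc m) ∣ ≡ k + a * K + ρ
      potential : 2 * coveredPairs Cs m + k ≡ k * ∣ prefix Cs (suc m) ∣ + ρ * ρ' + σ
      shape : σ ≡ 0 → Shape m Cs a ρ

  span : CliqueChain → Subset n
  span c = prefix (CliqueChain.Cs c) (suc (CliqueChain.m c))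

  singleton : 1 ≤ K → (D : Subset n) → IsKkCopy G k D → (w : Fin n) → w ∈ D → CliqueChain
  singleton 1≤K D D-clique w w∈D = record
    { m = 0 ; Cs = λ _ → D ; clique = λ _ _ → D-clique ; root = w ; root∈Cs₀ = w∈D
    ; a = 0 ; ρ = 0 ; ρ' = K ; σ = 0 ; ρ+ρ'≡K = refl ; 1≤ρ' = 1≤K
    ; size = trans ∣⊥∪D∣≡k (sym (trans (+-identityʳ (k + 0 * K)) (+-identityʳ k)))
    ; potential = begin
        2 * pairSum (λ u v → ⟦ inBoth D u v ⟧) + k  ≡⟨ cong (λ x → 2 * x + k) (pairSum-inside D) ⟩
        2 * (∣ D ∣ C 2) + k                        ≡⟨ cong (λ x → 2 * (x C 2) + k) (proj₁ D-clique) ⟩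
        2 * (k C 2) + k                            ≡⟨ cong (_+ k) (2*[1+n]C2≡[1+n]*n K) ⟩
        k * K + k                                  ≡⟨ square K ⟩
        k * k + 0 * K + 0                          ≡⟨ cong (λ x → k * x + 0 * K + 0) ∣⊥∪D∣≡k ⟨
        k * ∣ ⊥ ∪ D ∣ + 0 * K + 0                  ∎
    ; shape = λ _ → tree refl refl (λ { j (s≤s z≤n) () })
                         (λ T T⊆⊥∪D _ → 0 , z≤n , subst (_ ∈_) (∪-identityˡ D) ∘ T⊆⊥∪D) }
    where
    open ≡-Reasoning
    ∣⊥∪D∣≡k : ∣ ⊥ ∪ D ∣ ≡ k
    ∣⊥∪D∣≡k = trans (cong ∣_∣ (∪-identityˡ D)) (proj₁ D-clique)
    square : ∀ K → suc K * K + suc K ≡ suc K * suc K + 0 * K + 0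
    square = solve-∀

  module Append (c : CliqueChain) (D : Subset n) (D-clique : IsKkCopy G k D) {u v : Fin n}
                (u∈D : u ∈ D) (u∈W : u ∈ span c) (v∈D : v ∈ D) (v∉W : v ∉ span c) where
    open CliqueChain c

    W : Subset n
    W = span c

    Cs' : ℕ → Subset n
    Cs' = extend Cs m D

    T : Subset n
    T = D ∩ W

    span' : prefix Cs' (suc (suc m)) ≡ W ∪ D
    span' = cong₂ _∪_ (prefix-extend Cs m D ≤-refl) (extend-new Cs m D)

    attachment-new : attachment Cs' (suc m) ≡ ∣ T ∣
    attachment-new = cong₂ (λ p q → ∣ p ∩ q ∣) (extend-new Cs m D) (prefix-extend Cs m D ≤-refl)

    covered-new : ∀ x y → covered Cs' (suc m) x y ≡ covered Cs m x y ∨ inBoth D x y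
    covered-new x y =
      cong₂ _∨_ (covered-extend Cs m D ≤-refl x y) (cong (λ p → inBoth p x y) (extend-new Cs m D))

    clique' : ∀ i → i ≤ suc m → IsKkCopy G k (Cs' i)
    clique' i i≤1+m with m≤n⇒m<n∨m≡n i≤1+m
    ... | inj₁ (s≤s i≤m) = subst (IsKkCopy G k) (sym (extend-old Cs m D i≤m)) (clique i i≤m)
    ... | inj₂ refl = subst (IsKkCopy G k) (sym (extend-new Cs m D)) D-clique

    t' s : ℕ
    t' = pred ∣ T ∣
    s = K ∸ t'

    1+t'≡∣T∣ : suc t' ≡ ∣ T ∣
    1+t'≡∣T∣ = suc-pred ∣ T ∣ ⦃ >-nonZero (x∈p⇒1≤∣p∣ (x∈p∩q⁺ (u∈D , u∈W))) ⦄

    t'<K : t' < K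
    t'<K = ≤-pred (subst (λ x → suc x ≤ k) (sym 1+t'≡∣T∣) (subst (∣ T ∣ <_) (proj₁ D-clique) ∣T∣<∣D∣))
      where
      ∣T∣<∣D∣ : ∣ T ∣ < ∣ D ∣
      ∣T∣<∣D∣ = p⊂q⇒∣p∣<∣q∣ (p∩q⊆p D W , v , v∈D , v∉W ∘ proj₂ ∘ x∈p∩q⁻ D W)

    s+t'≡K : s + t' ≡ K
    s+t'≡K = m∸n+n≡m (<⇒≤ t'<K)

    1≤s : 1 ≤ s
    1≤s = m<n⇒0<n∸m t'<K

    ∣T∣+s≡k : ∣ T ∣ + s ≡ k
    ∣T∣+s≡k = trans (cong (_+ s) (sym 1+t'≡∣T∣)) (cong suc (trans (+-comm t' s) s+t'≡K))

    ∣W∪D∣≡∣W∣+s : ∣ W ∪ D ∣ ≡ ∣ W ∣ + s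
    ∣W∪D∣≡∣W∣+s = +-cancelʳ-≡ ∣ T ∣ _ _ (begin
      ∣ W ∪ D ∣ + ∣ T ∣       ≡⟨ cong (λ p → ∣ W ∪ D ∣ + ∣ p ∣) (∩-comm D W) ⟩
      ∣ W ∪ D ∣ + ∣ W ∩ D ∣   ≡⟨ ∣p∪q∣+∣p∩q∣≡∣p∣+∣q∣ W D ⟩
      ∣ W ∣ + ∣ D ∣           ≡⟨ cong (∣ W ∣ +_) (trans (proj₁ D-clique) (sym ∣T∣+s≡k)) ⟩
      ∣ W ∣ + (∣ T ∣ + s)     ≡⟨ x∙yz≈xz∙y (∣ W ∣) (∣ T ∣) s ⟩
      ∣ W ∣ + s + ∣ T ∣       ∎)
      where open ≡-Reasoning

    grows : ∣ W ∣ < ∣ prefix Cs' (suc (suc m)) ∣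
    grows = subst (∣ W ∣ <_) (sym (trans (cong ∣_∣ span') ∣W∪D∣≡∣W∣+s))
                  (subst (_≤ ∣ W ∣ + s) (+-comm ∣ W ∣ 1) (+-monoʳ-≤ ∣ W ∣ 1≤s))

    -- The lower bound presumes that every pair inside T was already covered; each of the δ pairs that
    -- were not adds 2 to the slack σ.
    ν δ : ℕ
    ν = pairSum (λ x y → ⟦ covered Cs m x y ∧ inBoth T x y ⟧)
    δ = pairSum (λ x y → ⟦ not (covered Cs m x y) ∧ inBoth T x y ⟧)

    covered-in-T : ∀ x y → covered Cs m x y ∧ inBoth T x y ≡ covered Cs m x y ∧ inBoth D x y
    covered-in-T x y with covered Cs m x y in eq
    ... | false = refl
    ... | true rewrite lookup-∩ D W x | lookup-∩ D W y
                     | ∈⇒lookup (proj₁ (covered⇒∈prefix m eq)) | ∈⇒lookup (proj₂ (covered⇒∈prefix m eq))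
                     | ∧-identityʳ (lookup D x) | ∧-identityʳ (lookup D y) = refl

    pairs-new : coveredPairs Cs' (suc m) + ν ≡ coveredPairs Cs m + k C 2
    pairs-new = begin
      coveredPairs Cs' (suc m) + ν
        ≡⟨ pairSum-distrib-+ (λ x y → ⟦ covered Cs' (suc m) x y ⟧) (λ x y → ⟦ covered Cs m x y ∧ inBoth T x y ⟧) ⟨
      pairSum (λ x y → ⟦ covered Cs' (suc m) x y ⟧ + ⟦ covered Cs m x y ∧ inBoth T x y ⟧)
        ≡⟨ pairSum-cong (λ x y _ → pointwise x y) ⟩
      pairSum (λ x y → ⟦ covered Cs m x y ⟧ + ⟦ inBoth D x y ⟧)
        ≡⟨ pairSum-distrib-+ (λ x y → ⟦ covered Cs m x y ⟧) (λ x y → ⟦ inBoth D x y ⟧) ⟩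
      coveredPairs Cs m + pairSum (λ x y → ⟦ inBoth D x y ⟧)
        ≡⟨ cong (coveredPairs Cs m +_) (trans (pairSum-inside D) (cong (_C 2) (proj₁ D-clique))) ⟩
      coveredPairs Cs m + k C 2 ∎
      where
      open ≡-Reasoning
      pointwise : ∀ x y → ⟦ covered Cs' (suc m) x y ⟧ + ⟦ covered Cs m x y ∧ inBoth T x y ⟧
                        ≡ ⟦ covered Cs m x y ⟧ + ⟦ inBoth D x y ⟧
      pointwise x y rewrite covered-new x y | covered-in-T x y = ⟦∨⟧+⟦∧⟧ (covered Cs m x y) (inBoth D x y)

    pairs-shared : ν + δ ≡ suc t' C 2
    pairs-shared = begin
      ν + δ
        ≡⟨ pairSum-distrib-+ (λ x y → ⟦ covered Cs m x y ∧ inBoth T x y ⟧)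
                             (λ x y → ⟦ not (covered Cs m x y) ∧ inBoth T x y ⟧) ⟨
      pairSum (λ x y → ⟦ covered Cs m x y ∧ inBoth T x y ⟧ + ⟦ not (covered Cs m x y) ∧ inBoth T x y ⟧)
        ≡⟨ pairSum-cong (λ x y _ → ⟦∧⟧+⟦not∧⟧ (covered Cs m x y) (inBoth T x y)) ⟩
      pairSum (λ x y → ⟦ inBoth T x y ⟧)
        ≡⟨ pairSum-inside T ⟩
      ∣ T ∣ C 2
        ≡⟨ cong (_C 2) 1+t'≡∣T∣ ⟨
      suc t' C 2 ∎
      where open ≡-Reasoning

    δ≡0⇒T-covered : δ ≡ 0 → ∀ {x y} → x ∈ T → y ∈ T → x ≢ y → covered Cs m x y ≡ true
    δ≡0⇒T-covered δ≡0 {x} {y} x∈T y∈T x≢y with covered Cs m x y in eq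
    ... | true = refl
    ... | false = contradiction (pairSum≡0⇒≡0-sym f f-sym δ≡0 x y x≢y)
                                (subst (λ b → ⟦ not b ∧ inBoth T x y ⟧ ≢ 0) (sym eq)
                                       (subst (λ b → ⟦ true ∧ b ⟧ ≢ 0) (sym (inBoth⁺ x∈T y∈T)) λ ()))
      where
      f = λ x y → ⟦ not (covered Cs m x y) ∧ inBoth T x y ⟧
      f-sym : ∀ x y → f x y ≡ f y x
      f-sym x y = cong₂ (λ c b → ⟦ not c ∧ b ⟧) (covered-sym Cs m x y) (∧-comm (lookup T x) (lookup T y))

    open RemainderStep (remainder-step {K} {s} {t'} {ρ} {ρ'} s+t'≡K ρ+ρ'≡K 1≤ρ')

    potential' : 2 * coveredPairs Cs' (suc m) + k
               ≡ k * ∣ prefix Cs' (suc (suc m)) ∣ + ρ₁ * ρ₁' + (σ + 2 * δ + excess)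
    potential' = begin
      2 * coveredPairs Cs' (suc m) + k
        ≡⟨ potential-step {w = ∣ W ∣} {P′ = coveredPairs Cs' (suc m)} {ν = ν} {δ = δ} {σ = σ}
                          {R = ρ * ρ'} {R₁ = ρ₁ * ρ₁'} {E = excess}
                          s+t'≡K pairs-new pairs-shared potential defect ⟩
      k * (∣ W ∣ + s) + ρ₁ * ρ₁' + (σ + 2 * δ + excess)
        ≡⟨ cong (λ w → k * w + ρ₁ * ρ₁' + (σ + 2 * δ + excess)) (trans (cong ∣_∣ span') ∣W∪D∣≡∣W∣+s) ⟨
      k * ∣ prefix Cs' (suc (suc m)) ∣ + ρ₁ * ρ₁' + (σ + 2 * δ + excess) ∎
      where open ≡-Reasoning

    covered-new⁻ : ∀ {x y} → covered Cs' (suc m) x y ≡ true → covered Cs m x y ≡ true ⊎ (x ∈ D × y ∈ D)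
    covered-new⁻ {x} {y} e = Sum.map₂ inBoth⁻ (∨≡true⁻ (trans (sym (covered-new x y)) e))

    -- A vertex of S outside W forces S ⊆ D; otherwise, as |T| = 1, no pair of S is covered by D alone.
    blocks-step : InOneBlock m Cs → t' ≡ 0 → InOneBlock (suc m) Cs'
    blocks-step blocks t'≡0 S S⊆W∪D S-covered with Fin.any? (λ x → x ∈? S ×-dec ¬? (x ∈? W))
    ... | yes (x , x∈S , x∉W) = suc m , ≤-refl , subst (S ⊆_) (sym (extend-new Cs m D)) S⊆D
      where
      S⊆D : S ⊆ D
      S⊆D {y} y∈S with y Fin.≟ x
      ... | yes refl = Sum.[ flip contradiction x∉W , id ]′ (x∈p∪q⁻ W D (subst (x ∈_) span' (S⊆W∪D x∈S)))
      ... | no y≢x = Sum.[ flip contradiction x∉W ∘ proj₁ ∘ covered⇒∈prefix m , proj₂ ]′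
                           (covered-new⁻ (S-covered x∈S y∈S (y≢x ∘ sym)))
    ... | no ∄x = let i , i≤m , S⊆Cᵢ = blocks S S⊆W S-covered-old in
                  i , m≤n⇒m≤1+n i≤m , subst (S ⊆_) (sym (extend-old Cs m D i≤m)) S⊆Cᵢ
      where
      S⊆W : S ⊆ W
      S⊆W {x} x∈S with x ∈? W
      ... | yes x∈W = x∈W
      ... | no x∉W = contradiction (x , x∈S , x∉W) ∄x
      S-covered-old : ∀ {x y} → x ∈ S → y ∈ S → x ≢ y → covered Cs m x y ≡ true
      S-covered-old x∈S y∈S x≢y with covered-new⁻ (S-covered x∈S y∈S x≢y)
      ... | inj₁ old = old
      ... | inj₂ (x∈D , y∈D) = contradiction
              (x,y∈p⇒2≤∣p∣ (x∈p∩q⁺ (x∈D , S⊆W x∈S)) (x∈p∩q⁺ (y∈D , S⊆W y∈S)) x≢y)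
              (subst (λ t → ¬ 2 ≤ t) (trans (sym (cong suc t'≡0)) 1+t'≡∣T∣) λ { (s≤s ()) })

    tight : σ + 2 * δ + excess ≡ 0 → σ ≡ 0 × δ ≡ 0 × excess ≡ 0
    tight e = m+n≡0⇒m≡0 σ σ+2δ≡0 , m+n≡0⇒m≡0 δ (m+n≡0⇒n≡0 σ σ+2δ≡0) , m+n≡0⇒n≡0 (σ + 2 * δ) e
      where σ+2δ≡0 = m+n≡0⇒m≡0 (σ + 2 * δ) e

    attachments-old : ∀ {j} → j ≤ suc m → j ≢ suc m → attachment Cs' j ≡ attachment Cs j
    attachments-old j≤1+m j≢1+m with m≤n⇒m<n∨m≡n j≤1+m
    ... | inj₁ (s≤s j≤m) = attachment-extend Cs m D j≤m
    ... | inj₂ j≡1+m = contradiction j≡1+m j≢1+m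

    shape-no-wrap : ρ + s ≡ ρ₁ → excess ≡ 2 * (ρ * s) → σ + 2 * δ + excess ≡ 0 → Shape (suc m) Cs' a ρ₁
    shape-no-wrap ρ+s≡ρ₁ excess≡2ρs e with tight e
    ... | σ≡0 , δ≡0 , excess≡0 with shape σ≡0
    ... | one-overlap 1≤ρ _ _ _ _ _ _ _ _ _ =
      Sum.[ (λ ρ≡0 → contradiction ρ≡0 (m<n⇒n≢0 1≤ρ)) , (λ s≡0 → contradiction s≡0 (m<n⇒n≢0 1≤s)) ]′
          (2*[m*n]≡0⇒ ρ s (trans (sym excess≡2ρs) excess≡0))
    ... | tree ρ≡0 m≡a attached blocks with blocks T (p∩q⊆q D W) (δ≡0⇒T-covered δ≡0)
    ...   | i , i≤m , T⊆Cᵢ =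
      one-overlap (subst (1 ≤_) (sym ρ₁≡s) 1≤s) (cong suc m≡a) (suc m) (s≤s z≤n) ≤-refl
        (trans (cong₂ _+_ attachment-new ρ₁≡s) ∣T∣+s≡k)
        (λ j 1≤j j≤1+m j≢1+m →
           trans (attachments-old j≤1+m j≢1+m) (attached j 1≤j (≤-pred (≤∧≢⇒< j≤1+m j≢1+m))))
        i (s≤s i≤m) meet
      where
      ρ₁≡s : ρ₁ ≡ s
      ρ₁≡s = trans (sym ρ+s≡ρ₁) (cong (_+ s) ρ≡0)
      Cᵢ∩D≡T : Cs i ∩ D ≡ T
      Cᵢ∩D≡T = ⊆-antisym
        (λ x∈Cᵢ∩D → let x∈Cᵢ , x∈D = x∈p∩q⁻ (Cs i) D x∈Cᵢ∩D in x∈p∩q⁺ (x∈D , ∈-prefix⁺ (s≤s i≤m) x∈Cᵢ))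
        (λ x∈T → x∈p∩q⁺ (T⊆Cᵢ x∈T , p∩q⊆p D W x∈T))
      meet : ∣ Cs' i ∩ Cs' (suc m) ∣ ≡ attachment Cs' (suc m)
      meet = trans (cong₂ (λ p q → ∣ p ∩ q ∣) (extend-old Cs m D i≤m) (extend-new Cs m D))
                      (trans (cong ∣_∣ Cᵢ∩D≡T) (sym attachment-new))

    shape-wrap : ρ + s ≡ K + ρ₁ → excess ≡ 2 * (t' * ρ') → σ + 2 * δ + excess ≡ 0 →
                 Shape (suc m) Cs' (suc a) ρ₁
    shape-wrap ρ+s≡K+ρ₁ excess≡2t'ρ' e with tight e
    ... | σ≡0 , δ≡0 , excess≡0 = extend-shape (shape σ≡0)
      where
      t'≡0 : t' ≡ 0
      t'≡0 = Sum.[ id , (λ ρ'≡0 → contradiction ρ'≡0 (m<n⇒n≢0 1≤ρ')) ]′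
                 (2*[m*n]≡0⇒ t' ρ' (trans (sym excess≡2t'ρ') excess≡0))
      ρ₁≡ρ : ρ₁ ≡ ρ
      ρ₁≡ρ = +-cancelˡ-≡ K ρ₁ ρ (trans (sym ρ+s≡K+ρ₁) (trans (+-comm ρ s)
                 (cong (_+ ρ) (trans (sym (+-identityʳ s)) (trans (cong (s +_) (sym t'≡0)) s+t'≡K)))))
      attached-new : attachment Cs' (suc m) ≡ 1
      attached-new = trans attachment-new (trans (sym 1+t'≡∣T∣) (cong suc t'≡0))
      attached' : ∀ {j} → 1 ≤ j → j ≤ suc m → (j ≤ m → attachment Cs j ≡ 1) → attachment Cs' j ≡ 1
      attached' 1≤j j≤1+m attached with m≤n⇒m<n∨m≡n j≤1+m
      ... | inj₁ (s≤s j≤m) = trans (attachment-extend Cs m D j≤m) (attached j≤m)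
      ... | inj₂ refl = attached-new
      extend-shape : Shape m Cs a ρ → Shape (suc m) Cs' (suc a) ρ₁
      extend-shape (tree ρ≡0 m≡a attached blocks) =
        tree (trans ρ₁≡ρ ρ≡0) (cong suc m≡a)
             (λ j 1≤j j≤1+m → attached' 1≤j j≤1+m (attached j 1≤j))
             (blocks-step blocks t'≡0)
      extend-shape (one-overlap 1≤ρ m≡1+a j₀ 1≤j₀ j₀≤m attached-j₀ attached i i<j₀ meet) =
        one-overlap (subst (1 ≤_) (sym ρ₁≡ρ) 1≤ρ) (cong suc m≡1+a) j₀ 1≤j₀ (m≤n⇒m≤1+n j₀≤m)
          (trans (cong₂ _+_ (attachment-extend Cs m D j₀≤m) ρ₁≡ρ) attached-j₀)
          (λ j 1≤j j≤1+m j≢j₀ → attached' 1≤j j≤1+m (λ j≤m → attached j 1≤j j≤m j≢j₀))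
          i i<j₀
          (trans (cong₂ (λ p q → ∣ p ∩ q ∣) (extend-old Cs m D i≤m) (extend-old Cs m D j₀≤m))
                 (trans meet (sym (attachment-extend Cs m D j₀≤m))))
        where
        i≤m : i ≤ m
        i≤m = ≤-trans (<⇒≤ i<j₀) j₀≤m

    appended : (a' : ℕ) → ∣ W ∪ D ∣ ≡ k + a' * K + ρ₁ → (σ + 2 * δ + excess ≡ 0 → Shape (suc m) Cs' a' ρ₁) →
             CliqueChain
    appended a' size' shape' = record
      { m = suc m ; Cs = Cs' ; clique = clique' ; root = root
      ; root∈Cs₀ = subst (root ∈_) (sym (extend-old Cs m D z≤n)) root∈Cs₀
      ; a = a' ; ρ = ρ₁ ; ρ' = ρ₁' ; σ = σ + 2 * δ + excess ; ρ+ρ'≡K = ρ₁+ρ₁'≡K ; 1≤ρ' = 1≤ρ₁'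
      ; size = trans (cong ∣_∣ span') size' ; potential = potential' ; shape = shape' }

    ∣W∪D∣≡k+aK+[ρ+s] : ∣ W ∪ D ∣ ≡ k + a * K + (ρ + s)
    ∣W∪D∣≡k+aK+[ρ+s] = trans ∣W∪D∣≡∣W∣+s (trans (cong (_+ s) size) (+-assoc (k + a * K) ρ s))

    next : Σ CliqueChain λ c' → ∣ W ∣ < ∣ span c' ∣
    next with carry
    ... | inj₁ (ρ+s≡ρ₁ , excess≡) =
      appended a (trans ∣W∪D∣≡k+aK+[ρ+s] (cong (k + a * K +_) ρ+s≡ρ₁)) (shape-no-wrap ρ+s≡ρ₁ excess≡) , grows
    ... | inj₂ (ρ+s≡K+ρ₁ , excess≡) =
      appended (suc a) (trans ∣W∪D∣≡k+aK+[ρ+s] (trans (cong (k + a * K +_) ρ+s≡K+ρ₁) (regroup k (a * K) K ρ₁)))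
               (shape-wrap ρ+s≡K+ρ₁ excess≡) , grows
      where
      regroup : ∀ k A K ρ₁ → k + A + (K + ρ₁) ≡ k + (K + A) + ρ₁
      regroup = solve-∀

  enlarge : Connected G → HasK1Cover G k → (c : CliqueChain) → ∀ {x} → x ∉ span c →
            Σ CliqueChain λ c' → ∣ span c ∣ < ∣ span c' ∣
  enlarge connected cover c {x} x∉W =
    let y , z , yz , y∈W , z∉W = crossing-edge (span c) (connected root x) root∈W x∉W
        D , D-clique , y∈D , z∈D = cover y z yz
    in Append.next c D D-clique y∈D y∈W z∈D z∉W
    where
    open CliqueChain c
    root∈W : root ∈ span c
    root∈W = ∈-prefix⁺ {Cs = Cs} (s≤s z≤n) root∈Cs₀

  grow : Connected G → HasK1Cover G k → (fuel : ℕ) (c : CliqueChain) → n ≤ ∣ span c ∣ + fuel →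
         Σ CliqueChain λ c → ∣ span c ∣ ≡ n
  grow connected cover fuel c bound with Fin.all? (_∈? span c)
  ... | yes all∈W = c , trans (cong ∣_∣ (⊆-antisym ⊆⊤ (λ {x} _ → all∈W x))) (∣⊤∣≡n n)
  ... | no ¬all∈W with Fin.¬∀⟶∃¬ n _ (_∈? span c) ¬all∈W
  ...   | x , x∉W with fuel
  ...     | zero = contradiction (subst (x ∈_) (sym W≡⊤) ∈⊤) x∉W
    where
    W≡⊤ : span c ≡ ⊤
    W≡⊤ = ∣p∣≡n⇒p≡⊤ (≤-antisym (∣p∣≤n (span c)) (subst (n ≤_) (+-identityʳ _) bound))
  ...     | suc fuel =
    let c' , grows = enlarge connected cover c x∉W in
    grow connected cover fuel c'
         (≤-trans bound (≤-trans (≤-reflexive (+-suc ∣ span c ∣ fuel)) (+-monoˡ-≤ fuel grows)))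

  spanning : 1 ≤ K → Connected G → HasK1Cover G k → ∀ {a b : Fin n} → a ≢ b →
             Σ CliqueChain λ c → ∣ span c ∣ ≡ n
  spanning 1≤K connected cover {a} {b} a≢b =
    let v , av = first-edge (connected a b) a≢b
        D , D-clique , a∈D , _ = cover a v av
    in grow connected cover n (singleton 1≤K D D-clique a a∈D) (m≤n+m n _)

  module SpanningChain (q r : ℕ) (1≤r : 1 ≤ r) (r≤K : r ≤ K) (n≡ : n ≡ k + q * K + r)
                       (edges : edgeCount G ≡ (q + 2) * (k C 2) ∸ ((k ∸ r) C 2))
                       (c : CliqueChain) (spans : ∣ span c ∣ ≡ n) where
    open CliqueChain c

    missing : ℕ
    missing = pairSum (λ u v → ⟦ adj G u v ∧ not (covered Cs m u v) ⟧)

    covered⇒adj : ∀ {u v} → u ≢ v → covered Cs m u v ≡ true → adj G u v ≡ true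
    covered⇒adj u≢v e = let i , i≤m , u∈ , v∈ = covered⁻ m e in proj₂ (clique i i≤m) _ _ u∈ v∈ u≢v

    covered+missing : coveredPairs Cs m + missing ≡ edgeCount G
    covered+missing = begin
      coveredPairs Cs m + missing
        ≡⟨ pairSum-distrib-+ (λ u v → ⟦ covered Cs m u v ⟧)
                             (λ u v → ⟦ adj G u v ∧ not (covered Cs m u v) ⟧) ⟨
      pairSum (λ u v → ⟦ covered Cs m u v ⟧ + ⟦ adj G u v ∧ not (covered Cs m u v) ⟧)
        ≡⟨ pairSum-cong (λ u v u≢v → pointwise (covered⇒adj u≢v)) ⟩
      pairSum (λ u v → ⟦ adj G u v ⟧)
        ≡⟨ edgeCount≡pairSum G ⟨
      edgeCount G ∎
      where
      open ≡-Reasoning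
      pointwise : ∀ {e c} → (c ≡ true → e ≡ true) → ⟦ c ⟧ + ⟦ e ∧ not c ⟧ ≡ ⟦ e ⟧
      pointwise {e} {false} _ = cong ⟦_⟧ (∧-identityʳ e)
      pointwise {e} {true} c⇒e rewrite c⇒e refl = refl

    open Extremal (extremal {q = q} {P = coveredPairs Cs m} {a = a} 1≤r r≤K n≡
                            (trans covered+missing edges)
                            (trans potential (cong (λ w → k * w + ρ * ρ' + σ) spans))
                            (trans (sym spans) size) ρ+ρ'≡K 1≤ρ')

    overlap⇒ρ≡r : 1 ≤ ρ → ρ ≡ r
    overlap⇒ρ≡r 1≤ρ with position
    ... | inj₁ (ρ≡0 , _) = contradiction ρ≡0 (m<n⇒n≢0 1≤ρ)
    ... | inj₂ (ρ≡r , _) = ρ≡r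

    m≡1+q : m ≡ suc q
    m≡1+q with shape σ≡0 | position
    ... | tree _ m≡a _ _ | inj₁ (_ , a≡1+q) = trans m≡a a≡1+q
    ... | tree ρ≡0 _ _ _ | inj₂ (ρ≡r , _) = contradiction (trans (sym ρ≡r) ρ≡0) (m<n⇒n≢0 1≤r)
    ... | one-overlap 1≤ρ _ _ _ _ _ _ _ _ _ | inj₁ (ρ≡0 , _) = contradiction ρ≡0 (m<n⇒n≢0 1≤ρ)
    ... | one-overlap _ m≡1+a _ _ _ _ _ _ _ _ | inj₂ (_ , a≡q) = trans m≡1+a (cong suc a≡q)

    exception-unique : ∀ {j j'} → 1 ≤ j → 1 ≤ j' → j ≤ m → j' ≤ m →
                       attachment Cs j ≢ 1 → attachment Cs j' ≢ 1 → j ≡ j'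
    exception-unique {j} {j'} 1≤j 1≤j' j≤m j'≤m ≢1 ≢1' with shape σ≡0
    ... | tree _ _ attached _ = contradiction (attached j 1≤j j≤m) ≢1
    ... | one-overlap _ _ j₀ _ _ _ attached _ _ _ with j ≟ j₀ | j' ≟ j₀
    ...   | yes j≡j₀ | yes j'≡j₀ = trans j≡j₀ (sym j'≡j₀)
    ...   | no j≢j₀ | _ = contradiction (attached j 1≤j j≤m j≢j₀) ≢1
    ...   | _ | no j'≢j₀ = contradiction (attached j' 1≤j' j'≤m j'≢j₀) ≢1'

    exception-meets : ∀ {j} → 1 ≤ j → j ≤ m → attachment Cs j ≢ 1 →
                      attachment Cs j ≡ k ∸ r × ∃ λ i → i < j × ∣ Cs i ∩ Cs j ∣ ≡ k ∸ r
    exception-meets {j} 1≤j j≤m ≢1 with shape σ≡0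
    ... | tree _ _ attached _ = contradiction (attached j 1≤j j≤m) ≢1
    ... | one-overlap 1≤ρ _ j₀ _ _ attached-j₀ attached i i<j₀ meet with j ≟ j₀
    ...   | no j≢j₀ = contradiction (attached j 1≤j j≤m j≢j₀) ≢1
    ...   | yes refl = attachment≡ , i , i<j₀ , trans meet attachment≡
      where
      attachment≡ : attachment Cs j ≡ k ∸ r
      attachment≡ = trans (sym (m+n∸n≡m (attachment Cs j) r))
                          (cong (_∸ r) (trans (cong (attachment Cs j +_) (sym (overlap⇒ρ≡r 1≤ρ))) attached-j₀))

    q+2≡1+m : q + 2 ≡ suc m
    q+2≡1+m = trans (+-comm q 2) (cong suc (sym m≡1+q))

    U : Fin (q + 2) → Subset n
    U j = Cs (toℕ j)

    toℕ≤m : ∀ (j : Fin (q + 2)) → toℕ j ≤ m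
    toℕ≤m j = ≤-pred (subst (toℕ j <_) q+2≡1+m (Fin.toℕ<n j))

    toFin : ∀ {i} → i ≤ m → Fin (q + 2)
    toFin {i} i≤m = fromℕ< (subst (i <_) (sym q+2≡1+m) (s≤s i≤m))

    toℕ-toFin : ∀ {i} (i≤m : i ≤ m) → toℕ (toFin i≤m) ≡ i
    toℕ-toFin i≤m = Fin.toℕ-fromℕ< _

    U-toFin : ∀ {i} (i≤m : i ≤ m) → U (toFin i≤m) ≡ Cs i
    U-toFin i≤m = cong Cs (toℕ-toFin i≤m)

    prefixUnion≡prefix : ∀ j → prefixUnion U j ≡ prefix Cs (toℕ j)
    prefixUnion≡prefix j = ⊆-antisym
      (λ x∈ → let i , i<j , x∈Uᵢ = ∈-prefixUnion⁻ U j x∈ in ∈-prefix⁺ i<j x∈Uᵢ)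
      (λ x∈ → let i , i<j , x∈Cᵢ = ∈-prefix⁻ x∈ ; i≤m = ≤-trans (<⇒≤ i<j) (toℕ≤m j) in
              ∈-prefixUnion⁺ U (subst (_< toℕ j) (sym (toℕ-toFin i≤m)) i<j) (subst (_ ∈_) (sym (U-toFin i≤m)) x∈Cᵢ))

    priorMeet≡attachment : ∀ j → priorMeet U j ≡ attachment Cs (toℕ j)
    priorMeet≡attachment j = cong (λ p → ∣ U j ∩ p ∣) (prefixUnion≡prefix j)

    covers : ∀ u v → Edge G u v → ∃ λ i → u ∈ U i × v ∈ U i
    covers u v uv = let i , i≤m , u∈ , v∈ = covered⁻ m uv-covered in
                    toFin i≤m , subst (u ∈_) (sym (U-toFin i≤m)) u∈ , subst (v ∈_) (sym (U-toFin i≤m)) v∈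
      where
      u≢v : u ≢ v
      u≢v refl = contradiction (trans (sym uv) (irrefl G u)) λ ()
      f = λ u v → ⟦ adj G u v ∧ not (covered Cs m u v) ⟧
      f-sym : ∀ u v → f u v ≡ f v u
      f-sym u v = cong₂ (λ e c → ⟦ e ∧ not c ⟧) (Graph.sym G u v) (covered-sym Cs m u v)
      uv-covered : covered Cs m u v ≡ true
      uv-covered with covered Cs m u v in eq
      ... | true = refl
      ... | false = contradiction (pairSum≡0⇒≡0-sym f f-sym missing≡0 u v u≢v)
                                  (subst (λ c → ⟦ adj G u v ∧ not c ⟧ ≢ 0) (sym eq)
                                         (subst (λ e → ⟦ e ∧ true ⟧ ≢ 0) (sym uv) λ ()))

    U-clique : ∀ j → IsKkCopy G k (U j)
    U-clique j = clique (toℕ j) (toℕ≤m j)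

    exceptional-unique : ∀ j j' → 1 ≤ toℕ j → 1 ≤ toℕ j' → priorMeet U j ≢ 1 → priorMeet U j' ≢ 1 → j ≡ j'
    exceptional-unique j j' 1≤j 1≤j' ≢1 ≢1' = Fin.toℕ-injective
      (exception-unique 1≤j 1≤j' (toℕ≤m j) (toℕ≤m j')
                        (≢1 ∘ trans (priorMeet≡attachment j)) (≢1' ∘ trans (priorMeet≡attachment j')))

    exceptional-meets : ∀ j → 1 ≤ toℕ j → priorMeet U j ≢ 1 →
                        priorMeet U j ≡ k ∸ r × ∃ λ i → toℕ i < toℕ j × ∣ U i ∩ U j ∣ ≡ k ∸ r
    exceptional-meets j 1≤j ≢1 =
      let attachment≡ , i , i<j , meet = exception-meets 1≤j (toℕ≤m j) (≢1 ∘ trans (priorMeet≡attachment j))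
          i≤m = ≤-trans (<⇒≤ i<j) (toℕ≤m j)
      in trans (priorMeet≡attachment j) attachment≡ , toFin i≤m ,
         subst (_< toℕ j) (sym (toℕ-toFin i≤m)) i<j ,
         trans (cong (λ p → ∣ p ∩ U j ∣) (U-toFin i≤m)) meet

lemma2p3 : (k n q r : ℕ) → 3 ≤ k → 1 ≤ r → r ≤ k ∸ 1 → n ≡ k + q * (k ∸ 1) + r →
    (G : Graph n) → Connected G → HasK1Cover G k →
    edgeCount G ≡ (q + 2) * (k C 2) ∸ ((k ∸ r) C 2) →
    ∃ λ (U : Fin (q + 2) → Subset n) →
      (∀ i → IsKkCopy G k (U i)) ×
      (∀ u v → Edge G u v → ∃ λ i → u ∈ U i × v ∈ U i) ×
      (∀ j j' → 1 ≤ toℕ j → 1 ≤ toℕ j' → priorMeet U j ≢ 1 → priorMeet U j' ≢ 1 → j ≡ j') ×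
      (∀ j → 1 ≤ toℕ j → priorMeet U j ≢ 1 →
        priorMeet U j ≡ k ∸ r × ∃ λ i → toℕ i < toℕ j × ∣ U i ∩ U j ∣ ≡ k ∸ r)
lemma2p3 (suc K@(suc (suc _))) n q r (s≤s (s≤s (s≤s _))) 1≤r r≤K refl G connected cover edges =
  U , U-clique , covers , exceptional-unique , exceptional-meets
  where
  open Greedy G K
  spanned = spanning (s≤s z≤n) connected cover {zero} {suc zero} λ ()
  open SpanningChain q r 1≤r r≤K refl edges (proj₁ spanned) (proj₂ spanned)
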